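{- Let $G=(V,E)$ be an undirected graph and $(X,Y)$ a separation of $G$ with $Z=X\cap Y$. Let $\mathcal{M}\subseteq Z$ and $B\subseteq V$ with $B\cap Z=\mathcal{M}$, and let $B_X=B\cap X$, $B_Y=B\cap Y$. Let $P_X$ be a partition of $B_X$ and $P_Y$ a partition of $B_Y$. Let $E_{\mathcal{M}}$ be the edge set of $G[\mathcal{M}]$. Let $G_X=(V_X,E_X)$ and $G_Y=(V_Y,E_Y)$ be acyclic induced subgraphs of $G[X]$ and $G[Y]$, respectively, such that $B_X\subseteq V_X$, $V_X\cap Z=\mathcal{M}$, $G_X$ has connected components for $B_X$ as described by $P_X$, $B_Y\subseteq V_Y$, $V_Y\cap Z=\mathcal{M}$, and $G_Y$ has connected components for $B_Y$ as described by $P_Y$. Let $G'_Y=(V_Y,E_Y\setminus E_{\mathcal{M}})$ and let $P'_Y$ be the partition of $B_Y$ describing the connected components of $G'_Y$ for $B_Y$. Then the graph $G[V_X\cup V_Y]$ is acyclic and has connected components for $B$ as described by $P_X\sqcup P_Y$ if and only if the pair $(P_X,P'_Y)$ is acyclic.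
   Context: A separation of $G$ is a pair $(X,Y)$ of vertex sets with $X\cup Y=V$ and no edges between $X\setminus Y$ and $Y\setminus X$. For a set $A$ and a partition $P$ of $A$ (whose parts are called blocks), a graph $G'$ has connected components for $A$ as described by $P$ if for all $u,v\in A$: $u,v$ lie in the same connected component of $G'$ iff they lie in a common block of $P$. Join: if $P,Q$ partition the same set, $P\sqcup Q$ is their finest common coarsening (obtained from $P$ by repeatedly merging two blocks that both intersect a common block of $Q$); if $P$ partitions $V_1$ and $Q$ partitions $V_2$, then $P\sqcup Q$ is the join of $P\cup\{\{x\}:x\in V_2\setminus V_1\}$ and $Q\cup\{\{x\}:x\in V_1\setminus V_2\}$. A pair $(P,Q)$ of partitions is acyclic if the following bipartite graph $F_{P,Q}$ is acyclic: it has a vertex $v_x$ for each element $x$ partitioned by $P$ or $Q$ and a vertex $u_p$ for each block $p\in P\cup Q$ (blocks of $P$ and of $Q$ taken as distinct vertices), with an edge $v_xu_p$ whenever $x\in p$. -}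

module Defs where

open import Level using (0ℓ)
open import Data.Nat using (ℕ; _≤_)
open import Data.Fin using (Fin)
open import Data.Fin.Subset using (Subset; _∈_; _∉_; _∪_; _∩_; _⊆_; Nonempty)
open import Data.List using (List; []; _∷_; length; lookup; _++_; [_])
open import Data.List.Relation.Unary.All using (All)
open import Data.List.Relation.Unary.Linked using (Linked)
open import Data.List.Relation.Unary.Unique.Propositional using (Unique)
open import Data.Product using (Σ; ∃; _×_; _,_)
open import Data.Sum using (_⊎_; inj₁; inj₂)
open import Data.Empty using (⊥)
open import Data.Unit using (⊤)
open import Relation.Nullary using (¬_)
open import Relation.Binary.PropositionalEquality using (_≡_)
open import Function.Bundles using (_⇔_)

record Graph (n : ℕ) : Set₁ where
  field
    Adj    : Fin n → Fin n → Set
    sym    : ∀ {u v} → Adj u v → Adj v u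
    irrefl : ∀ {u} → ¬ Adj u u
open Graph public

-- Generic (sub)graphs: a vertex predicate S and an edge relation R
-- (only edges between vertices of S are used).

data Walk {V : Set} (S : V → Set) (R : V → V → Set) : V → V → Set where
  here : ∀ {u} → S u → Walk S R u u
  step : ∀ {u w v} → S u → R u w → Walk S R w v → Walk S R u v

IsCycle : {V : Set} (S : V → Set) (R : V → V → Set) → V → List V → Set
IsCycle S R v vs =
  Unique (v ∷ vs) × (2 ≤ length vs) × All S (v ∷ vs) × Linked R (v ∷ vs ++ [ v ])

Acyclic : {V : Set} (S : V → Set) (R : V → V → Set) → Set
Acyclic {V} S R = ∀ (v : V) (vs : List V) → ¬ IsCycle S R v vs

Partition : ℕ → Set
Partition n = List (Subset n)

block : ∀ {n} (P : Partition n) → Fin (length P) → Subset n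
block P i = lookup P i

IsPartitionOf : ∀ {n} → Subset n → Partition n → Set
IsPartitionOf A P =
    (∀ i → Nonempty (block P i))
  × (∀ x → (x ∈ A) ⇔ (∃ λ i → x ∈ block P i))
  × (∀ i j x → x ∈ block P i → x ∈ block P j → i ≡ j)

SameBlock : ∀ {n} → Partition n → Fin n → Fin n → Set
SameBlock P u v = ∃ λ i → u ∈ block P i × v ∈ block P i

HasComponents : ∀ {n} (S : Fin n → Set) (R : Fin n → Fin n → Set)
                → Subset n → Partition n → Set
HasComponents S R A P =
  ∀ u v → u ∈ A → v ∈ A → (Walk S R u v ⇔ SameBlock P u v)

-- Join of partitions P of A₁ and Q of A₂: J is the finest common
-- coarsening of P and Q (each extended by singletons to A₁ ∪ A₂).
-- Singleton blocks are automatically contained in a block of any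
-- partition of A₁ ∪ A₂, so only the blocks of P and Q need checking.

Coarsens : ∀ {n} → Partition n → Partition n → Set
Coarsens S P = ∀ i → ∃ λ k → block P i ⊆ block S k

IsJoin : {n : ℕ} (A₁ A₂ : Subset n) (P Q J : Partition n) → Set
IsJoin {n} A₁ A₂ P Q J =
    IsPartitionOf (A₁ ∪ A₂) J
  × Coarsens J P
  × Coarsens J Q
  × (∀ (S : Partition n) → IsPartitionOf (A₁ ∪ A₂) S →
       Coarsens S P → Coarsens S Q → Coarsens S J)

-- Acyclic pair of partitions: the bipartite incidence graph F_{P,Q}.

FVertex : ∀ {n} → Partition n → Partition n → Set
FVertex {n} P Q = Fin n ⊎ (Fin (length P) ⊎ Fin (length Q))

FIn : ∀ {n} (P Q : Partition n) → FVertex P Q → Set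
FIn P Q (inj₁ x) = (∃ λ i → x ∈ block P i) ⊎ (∃ λ j → x ∈ block Q j)
FIn P Q (inj₂ _) = ⊤

FAdj : ∀ {n} (P Q : Partition n) → FVertex P Q → FVertex P Q → Set
FAdj P Q (inj₁ x) (inj₂ (inj₁ i)) = x ∈ block P i
FAdj P Q (inj₁ x) (inj₂ (inj₂ j)) = x ∈ block Q j
FAdj P Q (inj₂ (inj₁ i)) (inj₁ x) = x ∈ block P i
FAdj P Q (inj₂ (inj₂ j)) (inj₁ x) = x ∈ block Q j
FAdj P Q _ _ = ⊥

AcyclicPair : ∀ {n} → Partition n → Partition n → Set
AcyclicPair P Q = Acyclic (FIn P Q) (FAdj P Q)

IsSeparation : ∀ {n} → Graph n → Subset n → Subset n → Set
IsSeparation G X Y =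
    (∀ v → v ∈ X ∪ Y)
  × (∀ u v → u ∈ X → u ∉ Y → v ∈ Y → v ∉ X → ¬ Adj G u v)

_∈S : ∀ {n} → Subset n → Fin n → Set
(S ∈S) x = x ∈ S

AdjMinus : ∀ {n} → Graph n → Subset n → Fin n → Fin n → Set
AdjMinus G M u v = Adj G u v × ¬ (u ∈ M × v ∈ M)

module Submission where

-- No edge joins VX ∖ M to VY ∖ M, so a walk in G[VX ∪ VY] splits at its vertices in M into pieces
-- lying in G_X or in G'_Y (an edge inside M is counted on the X side), and between vertices of B
-- such a piece exists exactly when its ends share a block of PX, resp. PY'.
-- Connectivity: cutting a walk at M gives a chain of same-block steps, hence one block of the join;
-- conversely "joined by a walk" is an equivalence relation containing the blocks of PX and PY, hence
-- those of their join. Acyclicity: a cycle avoiding M lies in G_X or G_Y; a cycle through M visiting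
-- both sides reads off as a closed alternating sequence of blocks, i.e. a cycle of F_{PX,PY'}.
-- Conversely a cycle of F_{PX,PY'} strings pieces together into a closed walk that never backtracks
-- (at a change of side the two neighbours of the junction differ), so G[VX ∪ VY] has a cycle.

open import Defs hiding (sym)
open import Data.Bool using (true)
open import Data.Nat using (ℕ; suc; _≤_; s≤s; z≤n)
open import Data.Fin using (Fin; zero; suc)
open import Data.Fin.Properties using (_≟_; any?)
open import Data.Fin.Subset using (Subset; _∈_; _∉_; _∪_; _∩_; _⊆_; Nonempty)
open import Data.Fin.Subset.Properties using (_∈?_; x∈p∩q⁺; x∈p∩q⁻; x∈p∪q⁺; x∈p∪q⁻)
open import Data.List using (List; []; _∷_; length; _++_; [_]; _∷ʳ_; map; allFin; filter; cartesianProduct; lookup)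
open import Data.List.Properties using (++-assoc; ++-identityʳ)
open import Data.List.Relation.Unary.All as All using (All; []; _∷_)
open import Data.List.Relation.Unary.All.Properties using (++⁻ˡ; ∷ʳ⁺; ¬Any⇒All¬; all-filter)
open import Data.List.Relation.Unary.Any as Any using (Any; here; there)
open import Data.List.Relation.Unary.AllPairs using ([]; _∷_; allPairs?)
open import Data.List.Relation.Unary.Linked as Linked using (Linked; []; [-]; _∷_)
open import Data.List.Relation.Unary.Linked.Properties using (AllPairs⇒Linked)
open import Data.List.Relation.Unary.Unique.Propositional using (Unique)
open import Data.List.Relation.Unary.Unique.Propositional.Properties using (Unique[x∷xs]⇒x∉xs; filter⁺; allFin⁺)
open import Data.List.Membership.Propositional as List using ()
open import Data.List.Membership.Propositional.Properties using (∈-∃++; ∈-allFin; ∈-cartesianProduct⁺; ∈-filter⁺)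
open import Data.Product using (Σ; ∃; ∃₂; _×_; _,_; proj₁; proj₂)
open import Data.Sum using (_⊎_; inj₁; inj₂; [_,_]′)
open import Data.Sum.Properties using (≡-dec; inj₁-injective)
open import Data.Empty using (⊥; ⊥-elim)
open import Data.Unit using (⊤; tt)
open import Data.Vec as Vec using ()
open import Data.Vec.Properties using (lookup∘tabulate; []=⇒lookup; lookup⇒[]=)
open import Relation.Nullary using (¬_; Dec; yes; no; does; ¬?)
open import Relation.Nullary.Decidable using (_×-dec_; _⊎-dec_)
open import Relation.Binary.Definitions using (DecidableEquality)
open import Relation.Binary.PropositionalEquality using (_≡_; _≢_; refl; sym; trans; cong; subst)
open import Function.Base using (_∘_)
open import Function.Bundles using (_⇔_; mk⇔; Equivalence)

-- Walks and cycles

module WalkProperties {V : Set} {S : V → Set} {R : V → V → Set} where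

  infixr 5 _++ʷ_

  _++ʷ_ : ∀ {x y z} → Walk S R x y → Walk S R y z → Walk S R x z
  here _     ++ʷ q = q
  step s r p ++ʷ q = step s r (p ++ʷ q)

  start : ∀ {x y} → Walk S R x y → S x
  start (here s)     = s
  start (step s _ _) = s

  end : ∀ {x y} → Walk S R x y → S y
  end (here s)     = s
  end (step _ _ p) = end p

  reverse : (∀ {a b} → R a b → R b a) → ∀ {x y} → Walk S R x y → Walk S R y x
  reverse R-sym (here s)     = here s
  reverse R-sym (step s r p) = reverse R-sym p ++ʷ step (start p) (R-sym r) (here s)

  NonTrivial : ∀ {x y} → Walk S R x y → Set
  NonTrivial (here _)     = ⊥
  NonTrivial (step _ _ _) = ⊤

  distinct⇒nonTrivial : ∀ {x y} → x ≢ y → (p : Walk S R x y) → NonTrivial p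
  distinct⇒nonTrivial x≢x (here _)     = x≢x refl
  distinct⇒nonTrivial _   (step _ _ _) = tt

  ++-nonTrivial : ∀ {x y z} (p : Walk S R x y) (q : Walk S R y z) → NonTrivial p → NonTrivial (p ++ʷ q)
  ++-nonTrivial (step _ _ _) _ _ = tt

  Second : ∀ {x y} → Walk S R x y → V → Set
  Second (here _)             _ = ⊥
  Second (step {w = v} _ _ _) b = v ≡ b

  Penultimate : ∀ {x y} → Walk S R x y → V → Set
  Penultimate (here _)                       _ = ⊥
  Penultimate (step {u} _ _ (here _))        a = u ≡ a
  Penultimate (step _ _ p@(step _ _ _)) a = Penultimate p a

  second-edge : ∀ {x y b} (p : Walk S R x y) → Second p b → S b × R x b
  second-edge (step _ r p) refl = start p , r

  penultimate-edge : ∀ {x y a} (p : Walk S R x y) → Penultimate p a → S a × R a y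
  penultimate-edge (step s r (here _))     refl = s , r
  penultimate-edge (step _ _ p@(step _ _ _)) pen  = penultimate-edge p pen

  second-++ : ∀ {x y z b} (p : Walk S R x y) (q : Walk S R y z) →
              NonTrivial p → Second (p ++ʷ q) b → Second p b
  second-++ (step _ _ _) _ _ sec = sec

  NonBacktracking : ∀ {x y} → Walk S R x y → Set
  NonBacktracking (step {u} _ _ (step {w = v} s r p)) = u ≢ v × NonBacktracking (step s r p)
  NonBacktracking _                                   = ⊤

  ++-nonBacktracking : ∀ {x y z} (p : Walk S R x y) (q : Walk S R y z) →
                       NonBacktracking p → NonBacktracking q →
                       (∀ a b → Penultimate p a → Second q b → a ≢ b) → NonBacktracking (p ++ʷ q)
  ++-nonBacktracking (here _)                (here _)     _        nb-q _     = nb-q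
  ++-nonBacktracking (here _)                (step _ _ _) _        nb-q _     = nb-q
  ++-nonBacktracking (step _ _ (here _))     (here _)     _        _    _     = tt
  ++-nonBacktracking (step _ _ (here _))     (step _ _ _) _        nb-q apart = apart _ _ refl refl , nb-q
  ++-nonBacktracking (step _ _ p@(step _ _ _)) q          (ne , nb-p) nb-q apart =
    ne , ++-nonBacktracking p q nb-p nb-q apart

  nonBacktracking-tail : ∀ {x y w} {s : S x} {r : R x w} (p : Walk S R w y) →
                        NonBacktracking (step s r p) → NonBacktracking p
  nonBacktracking-tail (here _)     _        = tt
  nonBacktracking-tail (step _ _ _) (_ , nb) = nb

  removeBacktracking : DecidableEquality V → ∀ {x y} → Walk S R x y → Σ (Walk S R x y) NonBacktracking
  removeBacktracking _≟ᵥ_ (here s)           = here s , tt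
  removeBacktracking _≟ᵥ_ (step {x} s r p) with removeBacktracking _≟ᵥ_ p
  ... | here t , _ = step s r (here t) , tt
  ... | step {w = v} t r′ p′ , nb with x ≟ᵥ v
  ...   | yes refl = p′ , nonBacktracking-tail p′ nb
  ...   | no x≢v   = step s r (step t r′ p′) , x≢v , nb

module _ {V : Set} {S S′ : V → Set} {R R′ : V → V → Set}
         (f : ∀ {a} → S a → S′ a) (g : ∀ {a b} → R a b → R′ a b) where
  open WalkProperties

  mapʷ : ∀ {x y} → Walk S R x y → Walk S′ R′ x y
  mapʷ (here s)     = here (f s)
  mapʷ (step s r p) = step (f s) (g r) (mapʷ p)

  mapʷ-nonTrivial : ∀ {x y} (p : Walk S R x y) → NonTrivial p → NonTrivial (mapʷ p)
  mapʷ-nonTrivial (step _ _ _) _ = tt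

  mapʷ-second : ∀ {x y b} (p : Walk S R x y) → Second (mapʷ p) b → Second p b
  mapʷ-second (step _ _ _) sec = sec

  mapʷ-penultimate : ∀ {x y a} (p : Walk S R x y) → Penultimate (mapʷ p) a → Penultimate p a
  mapʷ-penultimate (step _ _ (here _))        pen = pen
  mapʷ-penultimate (step _ _ p@(step _ _ _)) pen = mapʷ-penultimate p pen

  mapʷ-nonBacktracking : ∀ {x y} (p : Walk S R x y) → NonBacktracking p → NonBacktracking (mapʷ p)
  mapʷ-nonBacktracking (here _)                  _         = tt
  mapʷ-nonBacktracking (step _ _ (here _))       _         = tt
  mapʷ-nonBacktracking (step _ _ p@(step _ _ _)) (ne , nb) = ne , mapʷ-nonBacktracking p nb

HasCycle : {V : Set} → (V → Set) → (V → V → Set) → Set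
HasCycle S R = ∃₂ λ v vs → IsCycle S R v vs

module _ {V : Set} where

  NoBacktrack : List V → Set
  NoBacktrack (a ∷ b ∷ c ∷ r) = a ≢ c × NoBacktrack (b ∷ c ∷ r)
  NoBacktrack _               = ⊤

  noBacktrack-tail : ∀ a l → NoBacktrack (a ∷ l) → NoBacktrack l
  noBacktrack-tail _ []          _        = tt
  noBacktrack-tail _ (_ ∷ [])    _        = tt
  noBacktrack-tail _ (_ ∷ _ ∷ _) (_ , nb) = nb

  noBacktrack-∷ʳ : ∀ {v} x y z zs → Unique (x ∷ y ∷ z ∷ zs) → All (v ≢_) (y ∷ z ∷ zs) →
                   NoBacktrack (x ∷ y ∷ z ∷ zs ∷ʳ v)
  noBacktrack-∷ʳ x y z []       ((_ ∷ x≢z ∷ []) ∷ _) (v≢y ∷ _) = x≢z , (λ y≡v → v≢y (sym y≡v)) , tt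
  noBacktrack-∷ʳ x y z (w ∷ ws) ((_ ∷ x≢z ∷ _) ∷ u)  (_ ∷ v≢)  = x≢z , noBacktrack-∷ʳ y z w ws u v≢

  module _ {S : V → Set} {R : V → V → Set} where
    open WalkProperties

    vertices : ∀ {x y} → Walk S R x y → List V
    vertices (here {u} _)     = u ∷ []
    vertices (step {u} _ _ p) = u ∷ vertices p

    vertices-all : ∀ {x y} (p : Walk S R x y) → All S (vertices p)
    vertices-all (here s)     = s ∷ []
    vertices-all (step s _ p) = s ∷ vertices-all p

    vertices-linked : ∀ {x y} (p : Walk S R x y) → Linked R (vertices p)
    vertices-linked (here _)                  = [-]
    vertices-linked (step _ r (here _))       = r ∷ [-]
    vertices-linked (step _ r p@(step _ _ _)) = r ∷ vertices-linked p

    vertices-noBacktrack : ∀ {x y} (p : Walk S R x y) → NonBacktracking p → NoBacktrack (vertices p)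
    vertices-noBacktrack (here _)                              _         = tt
    vertices-noBacktrack (step _ _ (here _))                   _         = tt
    vertices-noBacktrack (step _ _ (step _ _ (here _)))        (ne , _)  = ne , tt
    vertices-noBacktrack (step _ _ p@(step _ _ (step _ _ _))) (ne , nb) = ne , vertices-noBacktrack p nb

    end∈vertices : ∀ {x y} (p : Walk S R x y) → y List.∈ vertices p
    end∈vertices (here _)     = here refl
    end∈vertices (step _ _ p) = there (end∈vertices p)

module _ {V : Set} {a : V} where

  unique-∷ʳ : ∀ {l} → Unique l → All (a ≢_) l → Unique (l ∷ʳ a)
  unique-∷ʳ []       []         = [] ∷ []
  unique-∷ʳ (x≢ ∷ u) (a≢x ∷ a≢) = ∷ʳ⁺ x≢ (λ x≡a → a≢x (sym x≡a)) ∷ unique-∷ʳ u a≢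

  unique-prefix : ∀ xs {ys} → Unique (xs ++ a ∷ ys) → Unique (a ∷ xs)
  unique-prefix []       _          = [] ∷ []
  unique-prefix (x ∷ xs) (x≢ ∷ u) with unique-prefix xs u
  ... | a≢ ∷ u′ = (before xs x≢ ∷ a≢) ∷ ++⁻ˡ xs x≢ ∷ u′
    where
    before : ∀ {x} xs {ys} → All (x ≢_) (xs ++ a ∷ ys) → a ≢ x
    before []       (x≢a ∷ _) a≡x = x≢a (sym a≡x)
    before (_ ∷ xs) (_ ∷ x≢)       = before xs x≢

  module _ {R : V → V → Set} where

    linked-prefix : ∀ xs {ys} → Linked R (xs ++ a ∷ ys) → Linked R (xs ∷ʳ a)
    linked-prefix []           _        = [-]
    linked-prefix (_ ∷ [])     (r ∷ _)  = r ∷ [-]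
    linked-prefix (_ ∷ y ∷ xs) (r ∷ lk) = r ∷ linked-prefix (y ∷ xs) lk

    linked-∷ʳ⁻ : ∀ l → Linked R (l ∷ʳ a) → Linked R l
    linked-∷ʳ⁻ []          _        = []
    linked-∷ʳ⁻ (_ ∷ [])    _        = [-]
    linked-∷ʳ⁻ (_ ∷ y ∷ l) (r ∷ lk) = r ∷ linked-∷ʳ⁻ (y ∷ l) lk

    linked-∷ʳ : ∀ {b} l → Linked R (l ∷ʳ a) → R a b → Linked R (l ∷ʳ a ∷ʳ b)
    linked-∷ʳ []           _         r = r ∷ [-]
    linked-∷ʳ (_ ∷ [])     (r′ ∷ [-]) r = r′ ∷ r ∷ [-]
    linked-∷ʳ (_ ∷ y ∷ l)  (r′ ∷ lk) r = r′ ∷ linked-∷ʳ (y ∷ l) lk r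

module CycleProperties {V : Set} (_≟ᵥ_ : DecidableEquality V) {S : V → Set} {R : V → V → Set}
                       (R-irrefl : ∀ {a} → ¬ R a a) where
  open WalkProperties
  import Data.List.Membership.DecPropositional _≟ᵥ_ as DecMembership

  -- Pass to the shortest suffix that still repeats an element: its head recurs, and the segment up to the
  -- recurrence is a cycle (of length ≥ 3 by irreflexivity and NoBacktrack).
  repetition⇒cycle : ∀ l → All S l → Linked R l → NoBacktrack l → ¬ Unique l → HasCycle S R
  repetition⇒cycle []       _          _  _  ¬u = ⊥-elim (¬u [])
  repetition⇒cycle (a ∷ l) (sa ∷ s-l) lk nb ¬u with allPairs? (λ x y → ¬? (x ≟ᵥ y)) l
  ... | no ¬u-l = repetition⇒cycle l s-l (Linked.tail lk) (noBacktrack-tail a l nb) ¬u-l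
  ... | yes u-l with a DecMembership.∈? l
  ...   | no a∉l = ⊥-elim (¬u (¬Any⇒All¬ l a∉l ∷ u-l))
  ...   | yes a∈l with ∈-∃++ a∈l
  ...     | xs , ys , refl =
    a , xs , unique-prefix xs u-l , length≥2 xs lk nb , sa ∷ ++⁻ˡ xs s-l , linked-prefix (a ∷ xs) lk
    where
    length≥2 : ∀ xs → Linked R (a ∷ xs ++ a ∷ ys) → NoBacktrack (a ∷ xs ++ a ∷ ys) → 2 ≤ length xs
    length≥2 []          (r ∷ _) _        = ⊥-elim (R-irrefl r)
    length≥2 (_ ∷ [])    _       (a≢a , _) = ⊥-elim (a≢a refl)
    length≥2 (_ ∷ _ ∷ _) _       _        = s≤s (s≤s z≤n)

  closedWalk⇒cycle : ∀ {x} (p : Walk S R x x) → NonTrivial p → NonBacktracking p → HasCycle S R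
  closedWalk⇒cycle p@(step _ _ p′) _ nb =
    repetition⇒cycle (vertices p) (vertices-all p) (vertices-linked p) (vertices-noBacktrack p nb)
      (λ u → Unique[x∷xs]⇒x∉xs u (end∈vertices p′))

  private
    IsCycleList : List V → Set
    IsCycleList []       = ⊥
    IsCycleList (v ∷ vs) = IsCycle S R v vs

    rotate-one : ∀ x zs → IsCycleList (x ∷ zs) → IsCycleList (zs ∷ʳ x)
    rotate-one x []       (_ , () , _)
    rotate-one x (w ∷ ws) ((x≢ ∷ u) , len , (sx ∷ s-ws) , (r ∷ lk)) =
      unique-∷ʳ u x≢ , subst (2 ≤_) (sym (length-∷ʳ ws)) len , ∷ʳ⁺ s-ws sx , linked-∷ʳ (w ∷ ws) lk r
      where
      length-∷ʳ : ∀ (l : List V) → length (l ∷ʳ x) ≡ suc (length l)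
      length-∷ʳ []      = refl
      length-∷ʳ (_ ∷ l) = cong suc (length-∷ʳ l)

    rotate : ∀ xs ys → IsCycleList (xs ++ ys) → IsCycleList (ys ++ xs)
    rotate []       ys c = subst IsCycleList (sym (++-identityʳ ys)) c
    rotate (x ∷ xs) ys c = subst IsCycleList (++-assoc ys [ x ] xs)
      (rotate xs (ys ∷ʳ x) (subst IsCycleList (++-assoc xs ys [ x ]) (rotate-one x (xs ++ ys) c)))

  rotateTo : ∀ {u v vs} → IsCycle S R v vs → u List.∈ v ∷ vs → ∃ λ us → IsCycle S R u us
  rotateTo c u∈ with ∈-∃++ u∈
  ... | xs , ys , eq = ys ++ xs , rotate xs (_ ∷ ys) (subst IsCycleList eq c)

cycle-noBacktrack : ∀ {V : Set} {S : V → Set} {R : V → V → Set} {v vs} →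
                    IsCycle S R v vs → NoBacktrack (v ∷ vs ∷ʳ v)
cycle-noBacktrack {vs = _ ∷ []}    (_ , s≤s () , _)
cycle-noBacktrack {v = v} {a ∷ b ∷ r} (u@(v≢ ∷ _) , _) = noBacktrack-∷ʳ v a b r u v≢

-- Partitions and their join

module PartitionProperties {n} {A : Subset n} (P : Partition n) (P-part : IsPartitionOf A P) where

  block⊆ : ∀ {i x} → x ∈ block P i → x ∈ A
  block⊆ {i} {x} x∈ = Equivalence.from (proj₁ (proj₂ P-part) x) (i , x∈)

  block-unique : ∀ {i j x} → x ∈ block P i → x ∈ block P j → i ≡ j
  block-unique = proj₂ (proj₂ P-part) _ _ _

  sameBlock⇒∈ˡ : ∀ {x y} → SameBlock P x y → x ∈ A
  sameBlock⇒∈ˡ (_ , x∈ , _) = block⊆ x∈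

  sameBlock⇒∈ʳ : ∀ {x y} → SameBlock P x y → y ∈ A
  sameBlock⇒∈ʳ (_ , _ , y∈) = block⊆ y∈

  sameBlock-trans : ∀ {x y z} → SameBlock P x y → SameBlock P y z → SameBlock P x z
  sameBlock-trans (i , x∈ , y∈) (j , y∈′ , z∈) with block-unique y∈ y∈′
  ... | refl = i , x∈ , z∈

sameBlock? : ∀ {n} (P : Partition n) x y → Dec (SameBlock P x y)
sameBlock? P x y = any? (λ i → (x ∈? block P i) ×-dec (y ∈? block P i))

coarsens⇒sameBlock : ∀ {n} {P Q : Partition n} → Coarsens Q P → ∀ {x y} → SameBlock P x y → SameBlock Q x y
coarsens⇒sameBlock Q≽P (i , x∈ , y∈) with Q≽P i
... | k , P⊆Q = k , P⊆Q x∈ , P⊆Q y∈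

module LabelPartition {n} (A : Subset n) (label : Fin n → Fin n) where

  HasLabel : Fin n → Fin n → Set
  HasLabel c z = z ∈ A × label z ≡ c

  hasLabel? : ∀ c z → Dec (HasLabel c z)
  hasLabel? c z = (z ∈? A) ×-dec (label z ≟ c)

  fibre : Fin n → Subset n
  fibre c = Vec.tabulate (λ z → does (hasLabel? c z))

  fibre⁺ : ∀ {c z} → HasLabel c z → z ∈ fibre c
  fibre⁺ {c} {z} h = lookup⇒[]= z (fibre c) (trans (lookup∘tabulate _ z) (true-if (hasLabel? c z)))
    where
    true-if : (d : Dec (HasLabel c z)) → does d ≡ true
    true-if (yes _) = refl
    true-if (no ¬h) = ⊥-elim (¬h h)

  fibre⁻ : ∀ {c z} → z ∈ fibre c → HasLabel c z
  fibre⁻ {c} {z} z∈ = holds (hasLabel? c z) (trans (sym (lookup∘tabulate _ z)) ([]=⇒lookup z∈))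
    where
    holds : (d : Dec (HasLabel c z)) → does d ≡ true → HasLabel c z
    holds (yes h) _ = h
    holds (no _) ()

  Used : Fin n → Set
  Used c = ∃ (HasLabel c)

  used? : ∀ c → Dec (Used c)
  used? c = any? (hasLabel? c)

  labels : List (Fin n)
  labels = filter used? (allFin n)

  blocks : Partition n
  blocks = map fibre labels

  fibres⁻ : ∀ l j {z} → z ∈ lookup (map fibre l) j → z ∈ A × label z List.∈ l
  fibres⁻ (c ∷ l) zero    z∈ = proj₁ (fibre⁻ z∈) , here (proj₂ (fibre⁻ z∈))
  fibres⁻ (c ∷ l) (suc j) z∈ with fibres⁻ l j z∈
  ... | z∈A , c∈l = z∈A , there c∈l

  fibres⁺ : ∀ l {z} → z ∈ A → label z List.∈ l → ∃ λ j → z ∈ lookup (map fibre l) j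
  fibres⁺ (c ∷ l) z∈A (here eq)  = zero , fibre⁺ (z∈A , eq)
  fibres⁺ (c ∷ l) z∈A (there c∈) with fibres⁺ l z∈A c∈
  ... | j , z∈ = suc j , z∈

  fibres-sameLabel : ∀ l j {y z} → y ∈ lookup (map fibre l) j → z ∈ lookup (map fibre l) j → label y ≡ label z
  fibres-sameLabel (c ∷ l) zero    y∈ z∈ = trans (proj₂ (fibre⁻ y∈)) (sym (proj₂ (fibre⁻ z∈)))
  fibres-sameLabel (c ∷ l) (suc j) y∈ z∈ = fibres-sameLabel l j y∈ z∈

  fibres-closed : ∀ l j {y z} → y ∈ lookup (map fibre l) j → z ∈ A → label z ≡ label y →
                  z ∈ lookup (map fibre l) j
  fibres-closed (c ∷ l) zero    y∈ z∈A eq = fibre⁺ (z∈A , trans eq (proj₂ (fibre⁻ y∈)))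
  fibres-closed (c ∷ l) (suc j) y∈ z∈A eq = fibres-closed l j y∈ z∈A eq

  private
    label∈ : ∀ {c z} l j → z ∈ fibre c → z ∈ lookup (map fibre l) j → c List.∈ l
    label∈ l j z∈c z∈j = subst (List._∈ l) (proj₂ (fibre⁻ z∈c)) (proj₂ (fibres⁻ l j z∈j))

  fibres-disjoint : ∀ l → Unique l → ∀ i j z →
                    z ∈ lookup (map fibre l) i → z ∈ lookup (map fibre l) j → i ≡ j
  fibres-disjoint (c ∷ l) _       zero    zero    _ _   _   = refl
  fibres-disjoint (c ∷ l) u       zero    (suc j) _ z∈₀ z∈j = ⊥-elim (Unique[x∷xs]⇒x∉xs u (label∈ l j z∈₀ z∈j))
  fibres-disjoint (c ∷ l) u       (suc i) zero    _ z∈i z∈₀ = ⊥-elim (Unique[x∷xs]⇒x∉xs u (label∈ l i z∈₀ z∈i))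
  fibres-disjoint (c ∷ l) (_ ∷ u) (suc i) (suc j) z z∈i z∈j = cong suc (fibres-disjoint l u i j z z∈i z∈j)

  fibres-nonempty : ∀ l → All Used l → ∀ j → Nonempty (lookup (map fibre l) j)
  fibres-nonempty (c ∷ l) ((z , h) ∷ _) zero    = z , fibre⁺ h
  fibres-nonempty (c ∷ l) (_ ∷ used)    (suc j) = fibres-nonempty l used j

  isPartition : IsPartitionOf A blocks
  isPartition =
    fibres-nonempty labels (all-filter used? (allFin n)) ,
    (λ z → mk⇔ (λ z∈A → fibres⁺ labels z∈A (∈-filter⁺ used? (∈-allFin _) (z , z∈A , refl)))
               (λ (j , z∈) → proj₁ (fibres⁻ labels j z∈))) ,
    fibres-disjoint labels (filter⁺ used? (allFin⁺ n))

  sameBlock⇒sameLabel : ∀ {y z} → SameBlock blocks y z → label y ≡ label z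
  sameBlock⇒sameLabel (j , y∈ , z∈) = fibres-sameLabel labels j y∈ z∈

  coarsens : ∀ {A′ P} → IsPartitionOf A′ P → A′ ⊆ A →
             (∀ {y z} → SameBlock P y z → label y ≡ label z) → Coarsens blocks P
  coarsens {P = P} P-part A′⊆A P⇒sameLabel i =
    proj₁ y∈k ,
    λ z∈ → fibres-closed labels (proj₁ y∈k) (proj₂ y∈k) (∈A z∈) (P⇒sameLabel (i , z∈ , proj₂ y))
    where
    ∈A : ∀ {j z} → z ∈ block P j → z ∈ A
    ∈A z∈ = A′⊆A (PartitionProperties.block⊆ P P-part z∈)
    y : Nonempty (block P i)
    y = proj₁ P-part i
    y∈k : ∃ λ k → proj₁ y ∈ lookup blocks k
    y∈k = fibres⁺ labels (∈A (proj₂ y)) (∈-filter⁺ used? (∈-allFin _) (_ , ∈A (proj₂ y) , refl))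

-- Union–find by relabelling: processing every pair (x , y) with D x y merges the label classes of x and y.
module ClosureLabelling {n} {D : Fin n → Fin n → Set} (D? : ∀ x y → Dec (D x y))
                        {_∼_ : Fin n → Fin n → Set} (∼-refl : ∀ {x} → x ∼ x)
                        (∼-sym : ∀ {x y} → x ∼ y → y ∼ x)
                        (∼-trans : ∀ {x y z} → x ∼ y → y ∼ z → x ∼ z)
                        (D⇒∼ : ∀ {x y} → D x y → x ∼ y) where

  private
    Labelling = Fin n → Fin n

    Sound : Labelling → Set
    Sound f = ∀ x y → f x ≡ f y → x ∼ y

    merge : Labelling → Fin n → Fin n → Labelling
    merge f x y z with f z ≟ f y
    ... | yes _ = f x
    ... | no _  = f z

    merge-sound : ∀ f {x y} → x ∼ y → Sound f → Sound (merge f x y)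
    merge-sound f {x₀} {y₀} x₀∼y₀ f-sound x y eq with f x ≟ f y₀ | f y ≟ f y₀
    ... | yes p | yes q = f-sound x y (trans p (sym q))
    ... | yes p | no _  = ∼-trans (f-sound x y₀ p) (∼-trans (∼-sym x₀∼y₀) (f-sound x₀ y eq))
    ... | no _  | yes q = ∼-trans (f-sound x x₀ eq) (∼-trans x₀∼y₀ (∼-sym (f-sound y y₀ q)))
    ... | no _  | no _  = f-sound x y eq

    merge-joins : ∀ f x y → merge f x y x ≡ merge f x y y
    merge-joins f x y with f x ≟ f y | f y ≟ f y
    ... | _     | no ¬refl = ⊥-elim (¬refl refl)
    ... | yes p | yes _    = refl
    ... | no _  | yes _    = refl

    merge-preserves : ∀ f x y {a b} → f a ≡ f b → merge f x y a ≡ merge f x y b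
    merge-preserves f x y {a} {b} eq with f a ≟ f y | f b ≟ f y
    ... | yes _ | yes _ = refl
    ... | yes p | no ¬q = ⊥-elim (¬q (trans (sym eq) p))
    ... | no ¬p | yes q = ⊥-elim (¬p (trans eq q))
    ... | no _  | no _  = eq

    mergeIfD : Labelling → Fin n × Fin n → Labelling
    mergeIfD f (x , y) with D? x y
    ... | yes _ = merge f x y
    ... | no _  = f

    mergeAll : List (Fin n × Fin n) → Labelling → Labelling
    mergeAll []       f = f
    mergeAll (p ∷ ps) f = mergeAll ps (mergeIfD f p)

    mergeAll-sound : ∀ ps f → Sound f → Sound (mergeAll ps f)
    mergeAll-sound []             f sound = sound
    mergeAll-sound ((x , y) ∷ ps) f sound with D? x y
    ... | yes d = mergeAll-sound ps _ (merge-sound f (D⇒∼ d) sound)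
    ... | no _  = mergeAll-sound ps f sound

    mergeAll-preserves : ∀ ps f {a b} → f a ≡ f b → mergeAll ps f a ≡ mergeAll ps f b
    mergeAll-preserves []             f eq = eq
    mergeAll-preserves ((x , y) ∷ ps) f eq with D? x y
    ... | yes _ = mergeAll-preserves ps _ (merge-preserves f x y eq)
    ... | no _  = mergeAll-preserves ps f eq

    mergeAll-joins : ∀ ps f {x y} → (x , y) List.∈ ps → D x y → mergeAll ps f x ≡ mergeAll ps f y
    mergeAll-joins ((x , y) ∷ ps) f (here refl) d with D? x y
    ... | yes _ = mergeAll-preserves ps _ (merge-joins f x y)
    ... | no ¬d = ⊥-elim (¬d d)
    mergeAll-joins (p ∷ ps) f (there x,y∈) d = mergeAll-joins ps (mergeIfD f p) x,y∈ d

    allPairs : List (Fin n × Fin n)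
    allPairs = cartesianProduct (allFin n) (allFin n)

  label : Fin n → Fin n
  label = mergeAll allPairs (λ z → z)

  label-sound : ∀ {x y} → label x ≡ label y → x ∼ y
  label-sound = mergeAll-sound allPairs (λ z → z) (λ { _ _ refl → ∼-refl }) _ _

  label-complete : ∀ {x y} → D x y → label x ≡ label y
  label-complete = mergeAll-joins allPairs (λ z → z) (∈-cartesianProduct⁺ (∈-allFin _) (∈-allFin _))

join-sameBlock⇒ : ∀ {n} {A₁ A₂ : Subset n} {P Q J : Partition n} →
                  IsPartitionOf A₁ P → IsPartitionOf A₂ Q → IsJoin A₁ A₂ P Q J →
                  {_∼_ : Fin n → Fin n → Set} → (∀ {x} → x ∼ x) → (∀ {x y} → x ∼ y → y ∼ x) →
                  (∀ {x y z} → x ∼ y → y ∼ z → x ∼ z) →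
                  (∀ {x y} → SameBlock P x y → x ∼ y) → (∀ {x y} → SameBlock Q x y → x ∼ y) →
                  ∀ {x y} → SameBlock J x y → x ∼ y
join-sameBlock⇒ {A₁ = A₁} {A₂} {P} {Q} {J} P-part Q-part (_ , _ , _ , J-finest)
                ∼-refl ∼-sym ∼-trans P⇒∼ Q⇒∼ x~Jy =
  label-sound (sameBlock⇒sameLabel (coarsens⇒sameBlock {P = J} {blocks} blocks≽J x~Jy))
  where
  open ClosureLabelling (λ x y → sameBlock? P x y ⊎-dec sameBlock? Q x y) ∼-refl ∼-sym ∼-trans [ P⇒∼ , Q⇒∼ ]′
  open LabelPartition (A₁ ∪ A₂) label
  blocks≽J : Coarsens blocks J
  blocks≽J = J-finest blocks isPartition
    (coarsens {P = P} P-part (λ x∈ → x∈p∪q⁺ (inj₁ x∈)) (λ sb → label-complete (inj₁ sb)))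
    (coarsens {P = Q} Q-part (λ x∈ → x∈p∪q⁺ (inj₂ x∈)) (λ sb → label-complete (inj₂ sb)))

-- The two sides of the separation

module _ {n} {p q : Subset n} {x : Fin n} where

  ∩⁺ : x ∈ p → x ∈ q → x ∈ p ∩ q
  ∩⁺ x∈p x∈q = x∈p∩q⁺ (x∈p , x∈q)

  ∩⁻ˡ : x ∈ p ∩ q → x ∈ p
  ∩⁻ˡ x∈ = proj₁ (x∈p∩q⁻ p q x∈)

  ∩⁻ʳ : x ∈ p ∩ q → x ∈ q
  ∩⁻ʳ x∈ = proj₂ (x∈p∩q⁻ p q x∈)

data Side : Set where
  X-side Y-side : Side

_≟ˢ_ : DecidableEquality Side
X-side ≟ˢ X-side = yes refl
X-side ≟ˢ Y-side = no λ ()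
Y-side ≟ˢ X-side = no λ ()
Y-side ≟ˢ Y-side = yes refl

module Setting {n : ℕ} (G : Graph n) (X Y M B VX VY : Subset n) (PX : Partition n)
  (separation : IsSeparation G X Y) (M⊆X∩Y : M ⊆ (X ∩ Y)) (B∩X∩Y≡M : B ∩ (X ∩ Y) ≡ M)
  (PX-part : IsPartitionOf (B ∩ X) PX) (VX⊆X : VX ⊆ X) (VY⊆Y : VY ⊆ Y)
  (B∩X⊆VX : (B ∩ X) ⊆ VX) (VX∩X∩Y≡M : VX ∩ (X ∩ Y) ≡ M)
  (PX-components : HasComponents (VX ∈S) (Adj G) (B ∩ X) PX)
  (B∩Y⊆VY : (B ∩ Y) ⊆ VY) (VY∩X∩Y≡M : VY ∩ (X ∩ Y) ≡ M) where

  open WalkProperties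

  U : Subset n
  U = VX ∪ VY

  Region : Side → Subset n
  Region X-side = X
  Region Y-side = Y

  V[_] : Side → Subset n
  V[ X-side ] = VX
  V[ Y-side ] = VY

  -- On the Y side the edges of G[M] are removed; they are accounted to the X side.
  E[_] : Side → Fin n → Fin n → Set
  E[ X-side ] = Adj G
  E[ Y-side ] = AdjMinus G M

  Walkˢ : Side → Fin n → Fin n → Set
  Walkˢ s = Walk (V[ s ] ∈S) E[ s ]

  WalkU : Fin n → Fin n → Set
  WalkU = Walk (U ∈S) (Adj G)

  V⊆U : ∀ s {a} → a ∈ V[ s ] → a ∈ U
  V⊆U X-side a∈ = x∈p∪q⁺ (inj₁ a∈)
  V⊆U Y-side a∈ = x∈p∪q⁺ (inj₂ a∈)

  V⊆Region : ∀ s {a} → a ∈ V[ s ] → a ∈ Region s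
  V⊆Region X-side = VX⊆X
  V⊆Region Y-side = VY⊆Y

  B∩Region⊆V : ∀ s {a} → a ∈ B ∩ Region s → a ∈ V[ s ]
  B∩Region⊆V X-side = B∩X⊆VX
  B∩Region⊆V Y-side = B∩Y⊆VY

  E⊆Adj : ∀ s {a b} → E[ s ] a b → Adj G a b
  E⊆Adj X-side e = e
  E⊆Adj Y-side e = proj₁ e

  toU : ∀ s {a b} → Walkˢ s a b → WalkU a b
  toU s = mapʷ (V⊆U s) (E⊆Adj s)

  M⊆Region : ∀ s {a} → a ∈ M → a ∈ Region s
  M⊆Region X-side a∈M = ∩⁻ˡ (M⊆X∩Y a∈M)
  M⊆Region Y-side a∈M = ∩⁻ʳ {p = X} (M⊆X∩Y a∈M)

  M⊆B : ∀ {a} → a ∈ M → a ∈ B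
  M⊆B {a} a∈M = ∩⁻ˡ (subst (a ∈_) (sym B∩X∩Y≡M) a∈M)

  M⊆B∩Region : ∀ s {a} → a ∈ M → a ∈ B ∩ Region s
  M⊆B∩Region s a∈M = ∩⁺ (M⊆B a∈M) (M⊆Region s a∈M)

  M⊆V : ∀ s {a} → a ∈ M → a ∈ V[ s ]
  M⊆V s a∈M = B∩Region⊆V s (M⊆B∩Region s a∈M)

  VX∩VY⊆M : ∀ {a} → a ∈ VX → a ∈ VY → a ∈ M
  VX∩VY⊆M {a} a∈VX a∈VY = subst (a ∈_) VX∩X∩Y≡M (∩⁺ a∈VX (∩⁺ (VX⊆X a∈VX) (VY⊆Y a∈VY)))

  B∩X∩Y⊆M : ∀ {a} → a ∈ B ∩ X → a ∈ B ∩ Y → a ∈ M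
  B∩X∩Y⊆M {a} a∈BX a∈BY =
    subst (a ∈_) B∩X∩Y≡M (∩⁺ (∩⁻ˡ a∈BX) (∩⁺ (∩⁻ʳ {p = B} a∈BX) (∩⁻ʳ {p = B} a∈BY)))

  U-sides : ∀ {a} → a ∈ U → ∃ λ s → a ∈ V[ s ]
  U-sides a∈U with x∈p∪q⁻ VX VY a∈U
  ... | inj₁ a∈VX = X-side , a∈VX
  ... | inj₂ a∈VY = Y-side , a∈VY

  B-sides : ∀ {a} → a ∈ B → ∃ λ s → a ∈ B ∩ Region s
  B-sides {a} a∈B with x∈p∪q⁻ X Y (proj₁ separation a)
  ... | inj₁ a∈X = X-side , ∩⁺ a∈B a∈X
  ... | inj₂ a∈Y = Y-side , ∩⁺ a∈B a∈Y

  no-crossing : ∀ {a b} → a ∈ VX → a ∉ M → b ∈ VY → b ∉ M → ¬ Adj G a b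
  no-crossing {a} {b} a∈VX a∉M b∈VY b∉M =
    proj₂ separation a b (VX⊆X a∈VX) (λ a∈Y → a∉M (subst (a ∈_) VX∩X∩Y≡M (∩⁺ a∈VX (∩⁺ (VX⊆X a∈VX) a∈Y))))
                         (VY⊆Y b∈VY) (λ b∈X → b∉M (subst (b ∈_) VY∩X∩Y≡M (∩⁺ b∈VY (∩⁺ b∈X (VY⊆Y b∈VY)))))

  stay : ∀ s {a b} → a ∈ V[ s ] → a ∉ M → Adj G a b → b ∈ U → b ∈ V[ s ] × E[ s ] a b
  stay s {b = b} a∈V a∉M ab b∈U with b ∈? V[ s ] | U-sides b∈U
  stay X-side a∈V a∉M ab b∈U | yes b∈V | _ = b∈V , ab
  stay Y-side a∈V a∉M ab b∈U | yes b∈V | _ = b∈V , ab , λ (a∈M , _) → a∉M a∈M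
  stay X-side a∈V a∉M ab b∈U | no b∉V | X-side , b∈VX = ⊥-elim (b∉V b∈VX)
  stay X-side a∈V a∉M ab b∈U | no b∉V | Y-side , b∈VY = ⊥-elim (no-crossing a∈V a∉M b∈VY (b∉V ∘ M⊆V X-side) ab)
  stay Y-side a∈V a∉M ab b∈U | no b∉V | X-side , b∈VX =
    ⊥-elim (no-crossing b∈VX (b∉V ∘ M⊆V Y-side) a∈V a∉M (Graph.sym G ab))
  stay Y-side a∈V a∉M ab b∈U | no b∉V | Y-side , b∈VY = ⊥-elim (b∉V b∈VY)

  stay-along : ∀ s {a} l → a ∈ V[ s ] → Linked (Adj G) (a ∷ l) → All (_∉ M) (a ∷ l) → All (_∈ U) l →
               All (_∈ V[ s ]) (a ∷ l)
  stay-along s []      a∈V _         _            _          = a∈V ∷ []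
  stay-along s (b ∷ l) a∈V (ab ∷ lk) (a∉M ∷ ∉M-l) (b∈U ∷ U-l) =
    a∈V ∷ stay-along s l (proj₁ (stay s a∈V a∉M ab b∈U)) lk ∉M-l U-l

  enter : ∀ {a b} → a ∈ M → Adj G a b → b ∈ U → ∃ λ s → b ∈ V[ s ] × E[ s ] a b
  enter {b = b} a∈M ab b∈U with b ∈? VX | U-sides b∈U
  ... | yes b∈VX | _           = X-side , b∈VX , ab
  ... | no b∉VX  | X-side , b∈VX = ⊥-elim (b∉VX b∈VX)
  ... | no b∉VX  | Y-side , b∈VY = Y-side , b∈VY , ab , λ (_ , b∈M) → b∉VX (M⊆V X-side b∈M)

  module Components (PY J : Partition n) (PY-part : IsPartitionOf (B ∩ Y) PY)
                    (PY-components : HasComponents (VY ∈S) (Adj G) (B ∩ Y) PY)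
                    (J-join : IsJoin (B ∩ X) (B ∩ Y) PX PY J) where

    sideWalk⇒sameBlock : ∀ s {a b} → a ∈ B ∩ Region s → b ∈ B ∩ Region s → Walkˢ s a b → SameBlock J a b
    sideWalk⇒sameBlock X-side a∈ b∈ p =
      coarsens⇒sameBlock {P = PX} {J} (proj₁ (proj₂ J-join)) (Equivalence.to (PX-components _ _ a∈ b∈) p)
    sideWalk⇒sameBlock Y-side a∈ b∈ p =
      coarsens⇒sameBlock {P = PY} {J} (proj₁ (proj₂ (proj₂ J-join)))
        (Equivalence.to (PY-components _ _ a∈ b∈) (mapʷ (λ a∈ → a∈) proj₁ p))

    -- Cut the walk at its vertices in M ⊆ B; in between it stays on one side.
    walk⇒sameBlock : ∀ {u v} → WalkU u v → u ∈ B → v ∈ B → SameBlock J u v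
    walk⇒sameBlock {v = v} p u∈B v∈B with B-sides u∈B
    ... | s , u∈ = go (s , u∈ , here (B∩Region⊆V s u∈)) p
      where
      SideWalkFrom : Fin n → Fin n → Set
      SideWalkFrom a w = ∃ λ s → a ∈ B ∩ Region s × Walkˢ s a w

      close : ∀ {a w} → SideWalkFrom a w → w ∈ B → SameBlock J a w
      close (s , a∈ , q) w∈B = sideWalk⇒sameBlock s a∈ (∩⁺ w∈B (V⊆Region s (end q))) q

      go : ∀ {a w} → SideWalkFrom a w → WalkU w v → SameBlock J a v
      go q (here _) = close q v∈B
      go {w = w} q@(s , a∈ , q′) (step _ ww′ rest) with w ∈? M
      ... | yes w∈M with enter w∈M ww′ (start rest)
      ...   | s′ , w′∈ , e = PartitionProperties.sameBlock-trans J (proj₁ J-join) (close q (M⊆B w∈M))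
                               (go (s′ , M⊆B∩Region s′ w∈M , step (M⊆V s′ w∈M) e (here w′∈)) rest)
      go {w = w} (s , a∈ , q′) (step _ ww′ rest) | no w∉M with stay s (end q′) w∉M ww′ (start rest)
      ...   | w′∈ , e = go (s , a∈ , q′ ++ʷ step (end q′) e (here w′∈)) rest

    sameBlock⇒walk : ∀ {u v} → u ∈ B → SameBlock J u v → WalkU u v
    sameBlock⇒walk u∈B u~v
      with join-sameBlock⇒ {P = PX} {PY} {J} PX-part PY-part J-join {_∼_ = λ x y → x ≡ y ⊎ WalkU x y}
             (inj₁ refl) ∼-sym ∼-trans (side⇒∼ X-side {PX} PX-part PX-components)
             (side⇒∼ Y-side {PY} PY-part PY-components) u~v
      where
      ∼-sym : ∀ {x y} → x ≡ y ⊎ WalkU x y → y ≡ x ⊎ WalkU y x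
      ∼-sym (inj₁ refl) = inj₁ refl
      ∼-sym (inj₂ p)    = inj₂ (reverse (Graph.sym G) p)
      ∼-trans : ∀ {x y z} → x ≡ y ⊎ WalkU x y → y ≡ z ⊎ WalkU y z → x ≡ z ⊎ WalkU x z
      ∼-trans (inj₁ refl) q           = q
      ∼-trans (inj₂ p)    (inj₁ refl) = inj₂ p
      ∼-trans (inj₂ p)    (inj₂ q)    = inj₂ (p ++ʷ q)
      side⇒∼ : ∀ s {P} → IsPartitionOf (B ∩ Region s) P →
               HasComponents (V[ s ] ∈S) (Adj G) (B ∩ Region s) P →
               ∀ {x y} → SameBlock P x y → x ≡ y ⊎ WalkU x y
      side⇒∼ s {P} P-part P-components x~y = inj₂ (mapʷ (V⊆U s) (λ e → e)
        (Equivalence.from (P-components _ _ (sameBlock⇒∈ˡ x~y) (sameBlock⇒∈ʳ x~y)) x~y))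
        where open PartitionProperties P P-part
    ... | inj₂ p    = p
    ... | inj₁ refl = here (V⊆U _ (B∩Region⊆V _ (proj₂ (B-sides u∈B))))

    components : HasComponents (U ∈S) (Adj G) B J
    components u v u∈B v∈B = mk⇔ (λ p → walk⇒sameBlock p u∈B v∈B) (sameBlock⇒walk u∈B)

  module Acyclicity (PY′ : Partition n) (PY′-part : IsPartitionOf (B ∩ Y) PY′)
                    (PY′-components : HasComponents (VY ∈S) (AdjMinus G M) (B ∩ Y) PY′) where

    P[_] : Side → Partition n
    P[ X-side ] = PX
    P[ Y-side ] = PY′

    P-part : ∀ s → IsPartitionOf (B ∩ Region s) P[ s ]
    P-part X-side = PX-part
    P-part Y-side = PY′-part

    P-components : ∀ s → HasComponents (V[ s ] ∈S) E[ s ] (B ∩ Region s) P[ s ]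
    P-components X-side = PX-components
    P-components Y-side = PY′-components

    module P (s : Side) = PartitionProperties P[ s ] (P-part s)

    blockWalk : ∀ s {x y} → SameBlock P[ s ] x y → Walkˢ s x y
    blockWalk s x~y = Equivalence.from (P-components s _ _ (P.sameBlock⇒∈ˡ s x~y) (P.sameBlock⇒∈ʳ s x~y)) x~y

    walkBlock : ∀ s {x y} → x ∈ M → y ∈ M → Walkˢ s x y → SameBlock P[ s ] x y
    walkBlock s x∈M y∈M = Equivalence.to (P-components s _ _ (M⊆B∩Region s x∈M) (M⊆B∩Region s y∈M))

    -- The vertices just before and after a change of side at a junction in M are distinct:
    -- a common one would lie in VX ∩ VY = M, but the Y-side edge at the junction avoids M.
    junction-apart : ∀ {s s′ a e b} → s ≢ s′ → e ∈ M →
                     a ∈ V[ s ] × E[ s ] a e → b ∈ V[ s′ ] × E[ s′ ] e b → a ≢ b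
    junction-apart {X-side} {X-side} s≢s′ _   _                _                = ⊥-elim (s≢s′ refl)
    junction-apart {X-side} {Y-side} _    e∈M (a∈VX , _)       (b∈VY , _ , ¬MM) refl = ¬MM (e∈M , VX∩VY⊆M a∈VX b∈VY)
    junction-apart {Y-side} {X-side} _    e∈M (a∈VY , _ , ¬MM) (b∈VX , _)       refl = ¬MM (VX∩VY⊆M b∈VX a∈VY , e∈M)
    junction-apart {Y-side} {Y-side} s≢s′ _   _                _                = ⊥-elim (s≢s′ refl)

    record ChainWalk (s : Side) (x y : Fin n) : Set where
      field
        walk            : WalkU x y
        nonTrivial      : NonTrivial walk
        nonBacktracking : NonBacktracking walk
        firstEdge       : ∀ {q} → Second walk q → q ∈ V[ s ] × E[ s ] x q

    record Segment (s : Side) (x y : Fin n) : Set where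
      field
        walk            : Walkˢ s x y
        nonTrivial      : NonTrivial walk
        nonBacktracking : NonBacktracking walk

    segment : ∀ s {x y} → x ≢ y → SameBlock P[ s ] x y → Segment s x y
    segment s x≢y x~y with removeBacktracking _≟_ (blockWalk s x~y)
    ... | p , nb = record { walk = p ; nonTrivial = distinct⇒nonTrivial x≢y p ; nonBacktracking = nb }

    segment⇒chainWalk : ∀ {s x y} → Segment s x y → ChainWalk s x y
    segment⇒chainWalk {s} seg = record
      { walk            = toU s walk
      ; nonTrivial      = mapʷ-nonTrivial (V⊆U s) (E⊆Adj s) walk nonTrivial
      ; nonBacktracking = mapʷ-nonBacktracking (V⊆U s) (E⊆Adj s) walk nonBacktracking
      ; firstEdge       = λ sec → second-edge walk (mapʷ-second (V⊆U s) (E⊆Adj s) walk sec)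
      }
      where open Segment seg

    joinAt : ∀ {s s′ x e y} → s ≢ s′ → e ∈ M → Segment s x e → ChainWalk s′ e y → ChainWalk s x y
    joinAt {s} s≢s′ e∈M seg cw = record
      { walk            = ChainWalk.walk head ++ʷ walk
      ; nonTrivial      = ++-nonTrivial (ChainWalk.walk head) walk (ChainWalk.nonTrivial head)
      ; nonBacktracking = ++-nonBacktracking (ChainWalk.walk head) walk (ChainWalk.nonBacktracking head) nonBacktracking
          λ a b pen sec → junction-apart s≢s′ e∈M
            (penultimate-edge (Segment.walk seg) (mapʷ-penultimate (V⊆U s) (E⊆Adj s) (Segment.walk seg) pen))
            (firstEdge sec)
      ; firstEdge       = λ sec → ChainWalk.firstEdge head
          (second-++ (ChainWalk.walk head) walk (ChainWalk.nonTrivial head) sec)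
      }
      where
      open ChainWalk cw
      head : ChainWalk s _ _
      head = segment⇒chainWalk seg

    FV : Set
    FV = FVertex PX PY′

    BlockIndex : Set
    BlockIndex = Fin (length PX) ⊎ Fin (length PY′)

    FA : FV → FV → Set
    FA = FAdj PX PY′

    FI : FV → Set
    FI = FIn PX PY′

    sideOf : BlockIndex → Side
    sideOf (inj₁ _) = X-side
    sideOf (inj₂ _) = Y-side

    blockStep : ∀ b {x y} → FA (inj₁ x) (inj₂ b) → FA (inj₂ b) (inj₁ y) → SameBlock P[ sideOf b ] x y
    blockStep (inj₁ i) x∈ y∈ = i , x∈ , y∈
    blockStep (inj₂ i) x∈ y∈ = i , x∈ , y∈

    sides-differ : ∀ b b′ {x} → FA (inj₂ b) (inj₁ x) → FA (inj₁ x) (inj₂ b′) →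
                   _≢_ {A = FV} (inj₂ b) (inj₂ b′) → sideOf b ≢ sideOf b′
    sides-differ (inj₁ i) (inj₁ j) x∈i x∈j i≢j _ = i≢j (cong (inj₂ ∘ inj₁) (P.block-unique X-side x∈i x∈j))
    sides-differ (inj₂ i) (inj₂ j) x∈i x∈j i≢j _ = i≢j (cong (inj₂ ∘ inj₂) (P.block-unique Y-side x∈i x∈j))
    sides-differ (inj₁ i) (inj₂ j) _   _   _   ()
    sides-differ (inj₂ i) (inj₁ j) _   _   _   ()

    shared∈M : ∀ b b′ {x} → FA (inj₂ b) (inj₁ x) → FA (inj₁ x) (inj₂ b′) → sideOf b ≢ sideOf b′ → x ∈ M
    shared∈M (inj₁ i) (inj₁ j) _   _   s≢s′ = ⊥-elim (s≢s′ refl)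
    shared∈M (inj₁ i) (inj₂ j) x∈i x∈j _    = B∩X∩Y⊆M (P.block⊆ X-side x∈i) (P.block⊆ Y-side x∈j)
    shared∈M (inj₂ i) (inj₁ j) x∈i x∈j _    = B∩X∩Y⊆M (P.block⊆ X-side x∈j) (P.block⊆ Y-side x∈i)
    shared∈M (inj₂ i) (inj₂ j) _   _   s≢s′ = ⊥-elim (s≢s′ refl)

    fPath⇒chainWalk : ∀ x b l y → Linked FA (inj₁ x ∷ inj₂ b ∷ l ∷ʳ inj₁ y) →
                      NoBacktrack (inj₁ x ∷ inj₂ b ∷ l ∷ʳ inj₁ y) → ChainWalk (sideOf b) x y
    fPath⇒chainWalk x b [] y (x∈b ∷ y∈b ∷ [-]) (x≢y , _) =
      segment⇒chainWalk (segment _ (x≢y ∘ cong inj₁) (blockStep b x∈b y∈b))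
    fPath⇒chainWalk x b (inj₁ x′ ∷ inj₂ b′ ∷ l) y (x∈b ∷ x′∈b ∷ lk@(x′∈b′ ∷ _)) (x≢x′ , b≢b′ , nb) =
      joinAt s≢s′ (shared∈M b b′ x′∈b x′∈b′ s≢s′) (segment _ (x≢x′ ∘ cong inj₁) (blockStep b x∈b x′∈b))
             (fPath⇒chainWalk x′ b′ l y lk nb)
      where
      s≢s′ : sideOf b ≢ sideOf b′
      s≢s′ = sides-differ b b′ x′∈b x′∈b′ b≢b′
    fPath⇒chainWalk x (inj₁ _) (inj₂ _ ∷ _) y (_ ∷ () ∷ _) _
    fPath⇒chainWalk x (inj₂ _) (inj₂ _ ∷ _) y (_ ∷ () ∷ _) _
    fPath⇒chainWalk x b (inj₁ _ ∷ []) y (_ ∷ _ ∷ () ∷ _) _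
    fPath⇒chainWalk x b (inj₁ _ ∷ inj₁ _ ∷ _) y (_ ∷ _ ∷ () ∷ _) _

    _≟F_ : DecidableEquality FV
    _≟F_ = ≡-dec _≟_ (≡-dec _≟_ _≟_)

    FA-irrefl : ∀ {a} → ¬ FA a a
    FA-irrefl {inj₁ _}        ()
    FA-irrefl {inj₂ (inj₁ _)} ()
    FA-irrefl {inj₂ (inj₂ _)} ()

    module FCycles = CycleProperties _≟F_ {FI} {FA} FA-irrefl
    module UCycles = CycleProperties _≟_ {U ∈S} {Adj G} (Graph.irrefl G)

    cycle-throughElement : ∀ {v vs} → IsCycle FI FA v vs → ∃₂ λ x l → IsCycle FI FA (inj₁ x) l
    cycle-throughElement {inj₁ x}        c = x , _ , c
    cycle-throughElement {inj₂ _} {inj₁ x ∷ _} c = x , FCycles.rotateTo c (there (here refl))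
    cycle-throughElement {inj₂ (inj₁ _)} {inj₂ _ ∷ _} (_ , _ , _ , () ∷ _)
    cycle-throughElement {inj₂ (inj₂ _)} {inj₂ _ ∷ _} (_ , _ , _ , () ∷ _)

    acyclic⇒acyclicPair : Acyclic (U ∈S) (Adj G) → AcyclicPair PX PY′
    acyclic⇒acyclicPair U-acyclic v vs c with cycle-throughElement c
    ... | x , inj₂ b ∷ l , c′@(_ , _ , _ , lk) with UCycles.closedWalk⇒cycle walk nonTrivial nonBacktracking
      where open ChainWalk (fPath⇒chainWalk x b l x lk (cycle-noBacktrack c′))
    ...   | u , us , cu = U-acyclic u us cu
    acyclic⇒acyclicPair U-acyclic v vs c | x , inj₁ _ ∷ _ , (_ , _ , _ , () ∷ _)

    Step : Set
    Step = Side × Fin n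

    data Chain : Fin n → List Step → Set where
      []  : ∀ {x} → Chain x []
      _∷_ : ∀ {x s e ps} → SameBlock P[ s ] x e → Chain e ps → Chain x ((s , e) ∷ ps)

    Alternating : List Step → Set
    Alternating = Linked (λ p q → proj₁ p ≢ proj₁ q)

    OnSide : Side → List Step → Set
    OnSide s = All (λ p → proj₁ p ≡ s)

    FirstSide : Side → List Step → Set
    FirstSide _ []             = ⊥
    FirstSide s ((s′ , _) ∷ _) = s′ ≡ s

    firstSide-onSide : ∀ {s s′ ps} → FirstSide s ps → OnSide s′ ps → s ≡ s′
    firstSide-onSide {ps = _ ∷ _} refl (s≡s′ ∷ _) = s≡s′

    elements : List Step → List (Fin n)
    elements = map proj₂

    endpoint : Fin n → List Step → Fin n
    endpoint x []             = x
    endpoint _ ((_ , e) ∷ ps) = endpoint e ps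

    lastFrom : Fin n → List (Fin n) → Fin n
    lastFrom x []      = x
    lastFrom _ (y ∷ r) = lastFrom y r

    -- The alternating chain of blocks traversed by a walk from c ∈ M along the vertex list r.
    record Tour (c : Fin n) (r : List (Fin n)) : Set where
      field
        steps       : List Step
        chain       : Chain c steps
        alternating : Alternating steps
        ends        : endpoint c steps ≡ lastFrom c r
        covered     : ∀ {z} → z List.∈ elements steps → z List.∈ r
        unique      : Unique r → Unique (elements steps)
        oneSided    : ∀ s → OnSide s steps → All (_∈ V[ s ]) r

    emptyTour : ∀ {c} → Tour c []
    emptyTour = record
      { steps = [] ; chain = [] ; alternating = [] ; ends = refl
      ; covered = λ () ; unique = λ _ → [] ; oneSided = λ _ _ → [] }

    -- Consecutive blocks on the same side share an element, hence coincide and are merged.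
    consStep : ∀ {s c e r} → SameBlock P[ s ] c e → e ∈ M → Tour e r →
               Σ (Tour c (e ∷ r)) (FirstSide s ∘ Tour.steps)
    consStep {s} {e = e} c~e e∈M t with Tour.steps t | Tour.chain t | Tour.alternating t | Tour.ends t
                                      | Tour.covered t | Tour.unique t | Tour.oneSided t
    ... | [] | [] | _ | ends | _ | _ | oneSided = record
      { steps = (s , e) ∷ [] ; chain = c~e ∷ [] ; alternating = [-] ; ends = ends
      ; covered = λ { (here refl) → here refl } ; unique = λ _ → [] ∷ []
      ; oneSided = λ s′ _ → M⊆V s′ e∈M ∷ oneSided s′ [] } , refl
    ... | (s₁ , e₁) ∷ ps | e~e₁ ∷ ch | alt | ends | covered | unique | oneSided with s ≟ˢ s₁
    ...   | yes refl = record
      { steps = (s , e₁) ∷ ps ; chain = P.sameBlock-trans s c~e e~e₁ ∷ ch ; alternating = alt ; ends = ends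
      ; covered = there ∘ covered ; unique = λ { (_ ∷ u) → unique u }
      ; oneSided = λ s′ on → M⊆V s′ e∈M ∷ oneSided s′ on } , refl
    ...   | no s≢s₁ = record
      { steps = (s , e) ∷ (s₁ , e₁) ∷ ps ; chain = c~e ∷ e~e₁ ∷ ch ; alternating = s≢s₁ ∷ alt ; ends = ends
      ; covered = λ { (here refl) → here refl ; (there z∈) → there (covered z∈) }
      ; unique = λ { (e∉r ∷ u) → All.tabulate (λ z∈ → All.lookup e∉r (covered z∈)) ∷ unique u }
      ; oneSided = λ { s′ (_ ∷ on) → M⊆V s′ e∈M ∷ oneSided s′ on } } , refl

    -- tourSegment carries the open segment p, on side s, of the current step; it is closed at the next vertex in M.
    tour : ∀ {c} r → c ∈ M → Linked (Adj G) (c ∷ r) → All (_∈ U) r → lastFrom c r ∈ M → Tour c r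
    tourSegment : ∀ s {c w} r → c ∈ M → Walkˢ s c w → Linked (Adj G) (w ∷ r) → All (_∈ U) r →
                  lastFrom w r ∈ M → Σ (Tour c (w ∷ r)) (FirstSide s ∘ Tour.steps)

    tour []      _   _         _            _      = emptyTour
    tour (w ∷ r) c∈M (cw ∷ lk) (w∈U ∷ U-r) last∈M with enter c∈M cw w∈U
    ... | s , w∈V , e = proj₁ (tourSegment s r c∈M (step (M⊆V s c∈M) e (here w∈V)) lk U-r last∈M)

    tourSegment s {c} {w} r c∈M p lk U-r last∈M with w ∈? M
    ... | yes w∈M = consStep (walkBlock s c∈M w∈M p) w∈M (tour r w∈M lk U-r last∈M)
    tourSegment s []       c∈M p lk         U-r          last∈M | no w∉M = ⊥-elim (w∉M last∈M)
    tourSegment s (w′ ∷ r) c∈M p (ww′ ∷ lk) (w′∈U ∷ U-r) last∈M | no w∉M with stay s (end p) w∉M ww′ w′∈U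
    ... | w′∈V , e with tourSegment s r c∈M (p ++ʷ step (end p) e (here w′∈V)) lk U-r last∈M
    ...   | t , first = record
      { steps = steps ; chain = chain ; alternating = alternating ; ends = ends
      ; covered = there ∘ covered ; unique = λ { (_ ∷ u) → unique u }
      ; oneSided = λ s′ on → subst (λ s″ → _ ∈ V[ s″ ]) (firstSide-onSide first on) (end p) ∷ oneSided s′ on
      } , first
      where open Tour t

    blockVertex : ∀ s {x y} → SameBlock P[ s ] x y → FV
    blockVertex X-side (i , _) = inj₂ (inj₁ i)
    blockVertex Y-side (i , _) = inj₂ (inj₂ i)

    blockVertex-left : ∀ s {x y} (x~y : SameBlock P[ s ] x y) → FA (inj₁ x) (blockVertex s x~y)
    blockVertex-left X-side (_ , x∈ , _) = x∈
    blockVertex-left Y-side (_ , x∈ , _) = x∈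

    blockVertex-right : ∀ s {x y} (x~y : SameBlock P[ s ] x y) → FA (blockVertex s x~y) (inj₁ y)
    blockVertex-right X-side (_ , _ , y∈) = y∈
    blockVertex-right Y-side (_ , _ , y∈) = y∈

    blockVertex-≢ : ∀ {s s′ x y x′ y′} (x~y : SameBlock P[ s ] x y) (x′~y′ : SameBlock P[ s′ ] x′ y′) →
                    s ≢ s′ → blockVertex s x~y ≢ blockVertex s′ x′~y′
    blockVertex-≢ {X-side} {X-side} _ _ s≢s′ = ⊥-elim (s≢s′ refl)
    blockVertex-≢ {X-side} {Y-side} _ _ _    ()
    blockVertex-≢ {Y-side} {X-side} _ _ _    ()
    blockVertex-≢ {Y-side} {Y-side} _ _ s≢s′ = ⊥-elim (s≢s′ refl)

    elements∈F : ∀ s {x y} → SameBlock P[ s ] x y → FI (inj₁ x) × FI (inj₁ y)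
    elements∈F X-side (i , x∈ , y∈) = inj₁ (i , x∈) , inj₁ (i , y∈)
    elements∈F Y-side (i , x∈ , y∈) = inj₂ (i , x∈) , inj₂ (i , y∈)

    chainVertices : ∀ {x ps} → Chain x ps → List FV
    chainVertices {x} []                   = inj₁ x ∷ []
    chainVertices {x} (_∷_ {s = s} x~e ch) = inj₁ x ∷ blockVertex s x~e ∷ chainVertices ch

    chainVertices-linked : ∀ {x ps} (ch : Chain x ps) → Linked FA (chainVertices ch)
    chainVertices-linked []                        = [-]
    chainVertices-linked (_∷_ {s = s} x~e [])      = blockVertex-left s x~e ∷ blockVertex-right s x~e ∷ [-]
    chainVertices-linked (_∷_ {s = s} x~e ch@(_ ∷ _)) =
      blockVertex-left s x~e ∷ blockVertex-right s x~e ∷ chainVertices-linked ch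

    chainVertices-all : ∀ {x ps} (ch : Chain x ps) → FI (inj₁ x) → All FI (chainVertices ch)
    chainVertices-all []                   x∈F = x∈F ∷ []
    chainVertices-all (_∷_ {s = s} x~e ch) x∈F =
      x∈F ∷ block∈F s x~e ∷ chainVertices-all ch (proj₂ (elements∈F s x~e))
      where
      block∈F : ∀ s {x y} (x~y : SameBlock P[ s ] x y) → FI (blockVertex s x~y)
      block∈F X-side _ = tt
      block∈F Y-side _ = tt

    chainVertices-noBacktrack : ∀ {x ps} (ch : Chain x ps) → Alternating ps → Linked _≢_ (x ∷ elements ps) →
                                NoBacktrack (chainVertices ch)
    chainVertices-noBacktrack []                    _            _            = tt
    chainVertices-noBacktrack (_ ∷ [])              _            (x≢e ∷ _)    = x≢e ∘ inj₁-injective , tt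
    chainVertices-noBacktrack (x~e ∷ ch@(e~e′ ∷ _)) (s≢s′ ∷ alt) (x≢e ∷ dist) =
      x≢e ∘ inj₁-injective , blockVertex-≢ x~e e~e′ s≢s′ , chainVertices-noBacktrack ch alt dist

    endpoint∈chainVertices : ∀ {x ps} (ch : Chain x ps) → inj₁ (endpoint x ps) List.∈ chainVertices ch
    endpoint∈chainVertices []       = here refl
    endpoint∈chainVertices (_ ∷ ch) = there (there (endpoint∈chainVertices ch))

    closedChain⇒fCycle : ∀ {m s e ps} → Chain m ((s , e) ∷ ps) → Alternating ((s , e) ∷ ps) →
                        Linked _≢_ (m ∷ e ∷ elements ps) → endpoint e ps ≡ m → HasCycle FI FA
    closedChain⇒fCycle {s = s} ch@(m~e ∷ ch′) alt distinct ends =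
      FCycles.repetition⇒cycle (chainVertices ch) (chainVertices-all ch (proj₁ (elements∈F s m~e)))
        (chainVertices-linked ch) (chainVertices-noBacktrack ch alt distinct)
        (λ u → Unique[x∷xs]⇒x∉xs u (there (subst (λ z → inj₁ z List.∈ _) ends (endpoint∈chainVertices ch′))))

    endpoint∈elements : ∀ e q qs → endpoint e (q ∷ qs) List.∈ elements (q ∷ qs)
    endpoint∈elements _ _ []       = here refl
    endpoint∈elements _ (_ , e) (q ∷ qs) = there (endpoint∈elements e q qs)

    consecutive-distinct : ∀ {m e} q qs → Unique (e ∷ elements (q ∷ qs)) → endpoint e (q ∷ qs) ≡ m →
                           Linked _≢_ (m ∷ e ∷ elements (q ∷ qs))
    consecutive-distinct {e = e} q qs u@(e∉ ∷ _) ends =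
      (λ m≡e → All.lookup e∉ (endpoint∈elements e q qs) (trans (sym m≡e) (sym ends))) ∷ AllPairs⇒Linked u

    lastFrom-∷ʳ : ∀ c ws {m} → lastFrom c (ws ∷ʳ m) ≡ m
    lastFrom-∷ʳ _ []       = refl
    lastFrom-∷ʳ _ (w ∷ ws) = lastFrom-∷ʳ w ws

    module _ (side-acyclic : ∀ s → Acyclic (V[ s ] ∈S) (Adj G)) where
      notOneSided : ∀ {m ws} → m ∈ M → IsCycle (U ∈S) (Adj G) m ws → ∀ s → ¬ All (_∈ V[ s ]) (ws ∷ʳ m)
      notOneSided {m} {ws} m∈M (u , len , _ , lk) s V-ws =
        side-acyclic s m ws (u , len , M⊆V s m∈M ∷ ++⁻ˡ ws V-ws , lk)

      cycleThroughM⇒fCycle : ∀ {m ws} → m ∈ M → IsCycle (U ∈S) (Adj G) m ws → HasCycle FI FA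
      cycleThroughM⇒fCycle {m} {ws} m∈M c@(m∉ws ∷ u-ws , _ , m∈U ∷ U-ws , lk)
        with Tour.steps t | Tour.chain t | Tour.alternating t | trans (Tour.ends t) (lastFrom-∷ʳ m ws)
           | Tour.unique t (unique-∷ʳ u-ws m∉ws) | Tour.oneSided t
        where
        t : Tour m (ws ∷ʳ m)
        t = tour (ws ∷ʳ m) m∈M lk (∷ʳ⁺ U-ws m∈U) (subst (_∈ M) (sym (lastFrom-∷ʳ m ws)) m∈M)
      ... | []               | _  | _   | _    | _ | oneSided = ⊥-elim (notOneSided m∈M c X-side (oneSided X-side []))
      ... | (s , _) ∷ []     | _  | _   | _    | _ | oneSided = ⊥-elim (notOneSided m∈M c s (oneSided s (refl ∷ [])))
      ... | (s , e) ∷ q ∷ qs | ch | alt | ends | u | _        =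
        closedChain⇒fCycle ch alt (consecutive-distinct q qs u ends) ends

      acyclicPair⇒acyclic : AcyclicPair PX PY′ → Acyclic (U ∈S) (Adj G)
      acyclicPair⇒acyclic F-acyclic v vs c@(u , len , v∈U ∷ U-vs , lk) with Any.any? (_∈? M) (v ∷ vs)
      ... | yes some∈M with List.find some∈M
      ...   | m , m∈c , m∈M with UCycles.rotateTo c m∈c
      ...     | ws , c′ with cycleThroughM⇒fCycle m∈M c′
      ...       | f , fs , cf = F-acyclic f fs cf
      acyclicPair⇒acyclic F-acyclic v vs (u , len , v∈U ∷ U-vs , lk) | no none∈M with U-sides v∈U
      ... | s , v∈V =
        side-acyclic s v vs
          (u , len , stay-along s vs v∈V (linked-∷ʳ⁻ (v ∷ vs) lk) (¬Any⇒All¬ _ none∈M) U-vs , lk)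

lemma4p5 : ∀ {n : ℕ} (G : Graph n) (X Y M B VX VY : Subset n)
    (PX PY PY' J : Partition n) →
    IsSeparation G X Y →
    M ⊆ (X ∩ Y) →
    B ∩ (X ∩ Y) ≡ M →
    IsPartitionOf (B ∩ X) PX →
    IsPartitionOf (B ∩ Y) PY →
    VX ⊆ X →
    VY ⊆ Y →
    Acyclic (VX ∈S) (Adj G) →
    Acyclic (VY ∈S) (Adj G) →
    (B ∩ X) ⊆ VX →
    VX ∩ (X ∩ Y) ≡ M →
    HasComponents (VX ∈S) (Adj G) (B ∩ X) PX →
    (B ∩ Y) ⊆ VY →
    VY ∩ (X ∩ Y) ≡ M →
    HasComponents (VY ∈S) (Adj G) (B ∩ Y) PY →
    IsPartitionOf (B ∩ Y) PY' →
    HasComponents (VY ∈S) (AdjMinus G M) (B ∩ Y) PY' →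
    IsJoin (B ∩ X) (B ∩ Y) PX PY J →
    ((Acyclic ((VX ∪ VY) ∈S) (Adj G)
    × HasComponents ((VX ∪ VY) ∈S) (Adj G) B J)
    ⇔ AcyclicPair PX PY')
lemma4p5 G X Y M B VX VY PX PY PY′ J separation M⊆X∩Y B∩X∩Y≡M PX-part PY-part VX⊆X VY⊆Y
         VX-acyclic VY-acyclic B∩X⊆VX VX∩X∩Y≡M PX-components B∩Y⊆VY VY∩X∩Y≡M PY-components
         PY′-part PY′-components J-join =
  mk⇔ (λ (U-acyclic , _) → acyclic⇒acyclicPair U-acyclic)
      (λ F-acyclic → acyclicPair⇒acyclic side-acyclic F-acyclic , components)
  where
  open Setting G X Y M B VX VY PX separation M⊆X∩Y B∩X∩Y≡M PX-part VX⊆X VY⊆Y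
               B∩X⊆VX VX∩X∩Y≡M PX-components B∩Y⊆VY VY∩X∩Y≡M
  open Components PY J PY-part PY-components J-join
  open Acyclicity PY′ PY′-part PY′-components

  side-acyclic : ∀ s → Acyclic (V[ s ] ∈S) (Adj G)
  side-acyclic X-side = VX-acyclic
  side-acyclic Y-side = VY-acyclic
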